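{- Let $\vec\sigma:\vec\Gamma'\Rightarrow\vec\Gamma$ and $\vec\delta:\vec\Gamma''\Rightarrow\vec\Gamma'$ be unified substitutions and $n<|\vec\Gamma|$. Then $(\vec\sigma\circ\vec\delta)|_n=(\vec\sigma|_n)\circ(\vec\delta|_{L(\vec\sigma,n)})$.
   Context: Fix $\mathcal{N}\subseteq\mathbb{N}$, one of $\{1\}$, $\{0,1\}$, $\mathbb{N}$, $\{n\mid n\ge1\}$. Types $T::=B\mid\square T\mid S\longrightarrow T$; terms $t::=x\mid\mathsf{box}\,t\mid\mathsf{unbox}_n\,t\mid\lambda x.t\mid s\ t$ (names, up to $\alpha$); contexts $\Gamma::=\cdot\mid\Gamma,x:T$; context stacks $\vec\Gamma::=\epsilon\mid\vec\Gamma;\Gamma$ (last is topmost), $|\vec\Gamma|$ their length, $\vec\Gamma;\vec\Delta$ concatenation. Typing $\vec\Gamma\vdash t:T$: $x:T\in\Gamma\Rightarrow\vec\Gamma;\Gamma\vdash x:T$; $\vec\Gamma;\cdot\vdash t:T\Rightarrow\vec\Gamma\vdash\mathsf{box}\,t:\square T$; $\vec\Gamma\vdash t:\square T$, $|\vec\Delta|=n\in\mathcal{N}\Rightarrow\vec\Gamma;\vec\Delta\vdash\mathsf{unbox}_n\,t:T$; $\vec\Gamma;(\Gamma,x:S)\vdash t:T\Rightarrow\vec\Gamma;\Gamma\vdash\lambda x.t:S\longrightarrow T$; $\vec\Gamma\vdash t:S\longrightarrow T$, $\vec\Gamma\vdash s:S\Rightarrow\vec\Gamma\vdash t\ s:T$.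 A local substitution $\sigma:\vec\Gamma\Rightarrow\Gamma$ assigns to each $x:T\in\Gamma$ a term $\sigma(x)$ with $\vec\Gamma\vdash\sigma(x):T$. Unified substitutions: $\varepsilon;\sigma:\vec\Gamma\Rightarrow\epsilon;\Gamma$ for $\sigma:\vec\Gamma\Rightarrow\Gamma$; $(\vec\sigma;_n\sigma):\vec\Gamma;\vec\Gamma'\Rightarrow\vec\Delta;\Delta$ for $\vec\sigma:\vec\Gamma\Rightarrow\vec\Delta$, $|\vec\Gamma'|=n\in\mathcal{N}$, $\sigma:\vec\Gamma;\vec\Gamma'\Rightarrow\Delta$. Truncation offset: $L(\vec\sigma,0)=0$, $L(\vec\sigma;_n\sigma,1+m)=n+L(\vec\sigma,m)$. Truncation: $\vec\sigma|_0=\vec\sigma$, $(\vec\sigma;_m\sigma)|_{1+n}=\vec\sigma|_n$. Application $t[\vec\sigma]$: $x[\vec\sigma]=\sigma(x)$ ($\sigma$ the topmost local substitution); $(\mathsf{box}\,t)[\vec\sigma]=\mathsf{box}(t[\vec\sigma;_1()])$; $(\mathsf{unbox}_n\,t)[\vec\sigma]=\mathsf{unbox}_{L(\vec\sigma,n)}(t[\vec\sigma|_n])$; $(\lambda x.t)[\varepsilon;\sigma]=\lambda x.t[\varepsilon;(\sigma,x/x)]$, $(\lambda x.t)[\vec\sigma;_k\sigma]=\lambda x.t[\vec\sigma;_k(\sigma,x/x)]$; $(s\ t)[\vec\sigma]=s[\vec\sigma]\ t[\vec\sigma]$; local substitutions are substituted pointwise. Composition: $(\varepsilon;\sigma)\circ\vec\delta=\varepsilon;(\sigma[\vec\delta])$,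 $(\vec\sigma;_n\sigma)\circ\vec\delta=(\vec\sigma\circ(\vec\delta|_n));_{L(\vec\delta,n)}(\sigma[\vec\delta])$. -}

module Defs where

open import Data.Nat using (ℕ; zero; suc; _+_; _∸_; _≤_; _<ᵇ_; _≤ᵇ_)
open import Data.Bool using (Bool; true; false; if_then_else_)
open import Data.Sum using (_⊎_)
open import Data.Unit using (⊤)
open import Relation.Binary.PropositionalEquality using (_≡_)

-- The parameter 𝒩 ⊆ ℕ : one of {1}, {0,1}, ℕ, {n | n ≥ 1}

data Mode : Set where
  only1 zeroOrOne allℕ positive : Mode

InN : Mode → ℕ → Set
InN only1     n = n ≡ 1
InN zeroOrOne n = n ≡ 0 ⊎ n ≡ 1
InN allℕ      n = ⊤
InN positive  n = 1 ≤ n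

-- Types, contexts (snoc lists, last = most recent), context stacks
-- (snoc lists, last = topmost)

data Ty : Set where
  B    : Ty
  □    : Ty → Ty
  _⟶_ : Ty → Ty → Ty

data Ctx : Set where
  ·   : Ctx
  _▹_ : Ctx → Ty → Ctx

data Stack : Set where
  ε   : Stack
  _⨾_ : Stack → Ctx → Stack

len : Stack → ℕ
len ε         = 0
len (Γs ⨾ _) = suc (len Γs)

_++_ : Stack → Stack → Stack
Γs ++ ε        = Γs
Γs ++ (Δs ⨾ Δ) = (Γs ++ Δs) ⨾ Δ

-- Terms, with de Bruijn indices (terms up to α); a variable refers to
-- the topmost context, index 0 = the last entry.

data Term : Set where
  var   : ℕ → Term
  box   : Term → Term
  unbox : ℕ → Term → Term
  lam   : Term → Term
  app   : Term → Term → Term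

data _∋_∶_ : Ctx → ℕ → Ty → Set where
  here  : ∀ {Γ T} → (Γ ▹ T) ∋ 0 ∶ T
  there : ∀ {Γ S T x} → Γ ∋ x ∶ T → (Γ ▹ S) ∋ suc x ∶ T

data Typed (m : Mode) : Stack → Term → Ty → Set where
  tvar   : ∀ {Γs Γ x T} → Γ ∋ x ∶ T → Typed m (Γs ⨾ Γ) (var x) T
  tbox   : ∀ {Γs t T} → Typed m (Γs ⨾ ·) t T → Typed m Γs (box t) (□ T)
  tunbox : ∀ {Γs Δs t T n} → Typed m Γs t (□ T) → len Δs ≡ n → InN m n →
           Typed m (Γs ++ Δs) (unbox n t) T
  tlam   : ∀ {Γs Γ S T t} → Typed m (Γs ⨾ (Γ ▹ S)) t T →
           Typed m (Γs ⨾ Γ) (lam t) (S ⟶ T)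
  tapp   : ∀ {Γs S T s t} → Typed m Γs t (S ⟶ T) → Typed m Γs s S →
           Typed m Γs (app t s) T

-- Local substitutions: one term per entry of the target context
-- (snoc list; the last term is for de Bruijn index 0).

data LSubst : Set where
  []ˢ  : LSubst
  _▹ˢ_ : LSubst → Term → LSubst

data LTyped (m : Mode) (Γs : Stack) : LSubst → Ctx → Set where
  lnil  : LTyped m Γs []ˢ ·
  lcons : ∀ {σ Γ t T} → LTyped m Γs σ Γ → Typed m Γs t T →
          LTyped m Γs (σ ▹ˢ t) (Γ ▹ T)

data USubst : Set where
  ε⨾_    : LSubst → USubst
  _⨾[_]_ : USubst → ℕ → LSubst → USubst

data UTyped (m : Mode) : Stack → USubst → Stack → Set where
  uε    : ∀ {Γs σ Γ} → LTyped m Γs σ Γ → UTyped m Γs (ε⨾ σ) (ε ⨾ Γ)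
  ucons : ∀ {Γs Γs′ Δs Δ σs σ n} → UTyped m Γs σs Δs →
          len Γs′ ≡ n → InN m n → LTyped m (Γs ++ Γs′) σ Δ →
          UTyped m (Γs ++ Γs′) (σs ⨾[ n ] σ) (Δs ⨾ Δ)

-- The clauses for ε;σ with a
-- positive argument never arise for well-typed data with n < |Γ⃗|;
-- they are given arbitrary default values to make the functions total.

L : USubst → ℕ → ℕ
L σs          zero    = 0
L (ε⨾ σ)      (suc m) = 0
L (σs ⨾[ n ] σ) (suc m) = n + L σs m

_∣_ : USubst → ℕ → USubst
σs            ∣ zero  = σs
(ε⨾ σ)        ∣ suc n = ε⨾ σ
(σs ⨾[ m ] σ) ∣ suc n = σs ∣ n

-- Weakening of the topmost context (needed with de Bruijn indices for
-- the extension (σ , x/x) under a binder).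
-- shift d c t : insert a fresh variable at position c in the context
-- that is d layers below the top of t's stack.

isZero : ℕ → Bool
isZero zero    = true
isZero (suc _) = false

shift : ℕ → ℕ → Term → Term
shift d c (var x)     = if isZero d then (if x <ᵇ c then var x else var (suc x)) else var x
shift d c (box t)     = box (shift (suc d) c t)
shift d c (unbox n t) = if n ≤ᵇ d then unbox n (shift (d ∸ n) c t) else unbox n t
shift d c (lam t)     = lam (shift d (if isZero d then suc c else c) t)
shift d c (app s t)   = app (shift d c s) (shift d c t)

wk : Term → Term
wk = shift 0 0

wkL : LSubst → LSubst
wkL []ˢ       = []ˢ
wkL (σ ▹ˢ t) = wkL σ ▹ˢ wk t

wkU : USubst → USubst
wkU (ε⨾ σ)        = ε⨾ wkL σ
wkU (σs ⨾[ k ] σ) = (if isZero k then wkU σs else σs) ⨾[ k ] wkL σ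

ext : USubst → USubst
ext (ε⨾ σ)        = ε⨾ (wkL σ ▹ˢ var 0)
ext (σs ⨾[ k ] σ) = (if isZero k then wkU σs else σs) ⨾[ k ] (wkL σ ▹ˢ var 0)

lookupL : LSubst → ℕ → Term
lookupL []ˢ       x       = var x
lookupL (σ ▹ˢ t) zero    = t
lookupL (σ ▹ˢ t) (suc x) = lookupL σ x

top : USubst → LSubst
top (ε⨾ σ)        = σ
top (σs ⨾[ _ ] σ) = σ

_[_] : Term → USubst → Term
var x     [ σs ] = lookupL (top σs) x
box t     [ σs ] = box (t [ σs ⨾[ 1 ] []ˢ ])
unbox n t [ σs ] = unbox (L σs n) (t [ σs ∣ n ])
lam t     [ σs ] = lam (t [ ext σs ])
app s t   [ σs ] = app (s [ σs ]) (t [ σs ])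

_[_]ˡ : LSubst → USubst → LSubst
[]ˢ       [ δs ]ˡ = []ˢ
(σ ▹ˢ t) [ δs ]ˡ = (σ [ δs ]ˡ) ▹ˢ (t [ δs ])

_∘ᵘ_ : USubst → USubst → USubst
(ε⨾ σ)        ∘ᵘ δs = ε⨾ (σ [ δs ]ˡ)
(σs ⨾[ n ] σ) ∘ᵘ δs = (σs ∘ᵘ (δs ∣ n)) ⨾[ L δs n ] (σ [ δs ]ˡ)

{-# OPTIONS --safe #-}
module Submission where

open import Defs
open import Data.Nat using (ℕ; _<_; zero; suc; _+_)
open import Relation.Binary.PropositionalEquality using (_≡_; refl; cong; module ≡-Reasoning)

-- The typing hypotheses are not needed: thanks to the default clauses of L and
-- truncation, the identity holds for all unified substitutions, typed or not.

∣-∣ : (δs : USubst) (a b : ℕ) → (δs ∣ a) ∣ b ≡ δs ∣ (a + b)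
∣-∣ δs            zero    b       = refl
∣-∣ (ε⨾ σ)        (suc a) zero    = refl
∣-∣ (ε⨾ σ)        (suc a) (suc b) = refl
∣-∣ (δs ⨾[ k ] σ) (suc a) b       = ∣-∣ δs a b

∘ᵘ-∣ : (σs δs : USubst) (n : ℕ) → (σs ∘ᵘ δs) ∣ n ≡ (σs ∣ n) ∘ᵘ (δs ∣ L σs n)
∘ᵘ-∣ σs            δs zero    = refl
∘ᵘ-∣ (ε⨾ σ)        δs (suc n) = refl
∘ᵘ-∣ (σs ⨾[ k ] σ) δs (suc n) = begin
  (σs ∘ᵘ (δs ∣ k)) ∣ n              ≡⟨ ∘ᵘ-∣ σs (δs ∣ k) n ⟩
  (σs ∣ n) ∘ᵘ ((δs ∣ k) ∣ L σs n)   ≡⟨ cong ((σs ∣ n) ∘ᵘ_) (∣-∣ δs k (L σs n)) ⟩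
  (σs ∣ n) ∘ᵘ (δs ∣ (k + L σs n))   ∎
  where open ≡-Reasoning

lemma3p11 : (m : Mode) (Γs Γs′ Γs″ : Stack) (σs δs : USubst) (n : ℕ) →
    UTyped m Γs′ σs Γs → UTyped m Γs″ δs Γs′ → n < len Γs →
    (σs ∘ᵘ δs) ∣ n ≡ (σs ∣ n) ∘ᵘ (δs ∣ L σs n)
lemma3p11 _ _ _ _ σs δs n _ _ _ = ∘ᵘ-∣ σs δs n
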